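{- Let $q$ be a prime power, $m\ge2,\ell\ge1$ integers with $\ell\mid m$, $\ell<m$ and $m/\ell$ even, and let $\alpha$ be a primitive element of $\mathbb F_{q^m}$. For $0\le j\le q^\ell$ let $\Gamma^{(j)}_{q,m,\ell}$ be the Cayley graph $X(\mathbb F_{q^m},\alpha^jS_\ell)$. Then $\bar\Gamma_{q,m}(\ell)=\Gamma^{(1)}_{q,m,\ell}\cup\cdots\cup\Gamma^{(q^\ell)}_{q,m,\ell}$ (same vertex set $\mathbb F_{q^m}$, union of edge sets), and $\Gamma^{(j)}_{q,m,\ell}\simeq\Gamma_{q,m}(\ell)$ for every $j=1,\dots,q^\ell$.
   Context: $S_\ell=\{x^{q^\ell+1}:x\in\mathbb F_{q^m}^*\}$. For a subset $S\subseteq\mathbb F_{q^m}$, $X(\mathbb F_{q^m},S)$ is the Cayley graph with vertex set $\mathbb F_{q^m}$ and $x\sim y$ iff $y-x\in S$. $\Gamma_{q,m}(\ell)=X(\mathbb F_{q^m},S_\ell)$ and $\bar\Gamma_{q,m}(\ell)$ is its complement. -}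

module Defs where

open import Level using (0ℓ)
open import Data.Nat using (ℕ; zero; suc; _^_; _≤_; _<_) renaming (_+_ to _+ℕ_)
open import Data.Nat.Primality using (Prime)
open import Data.Fin using (Fin)
open import Data.Product using (Σ; ∃; ∃-syntax; _×_; _,_)
open import Data.Empty using (⊥)
open import Relation.Nullary using (¬_)
open import Relation.Binary.PropositionalEquality using (_≡_; _≢_)
open import Algebra.Structures using (IsCommutativeRing)
open import Function.Bundles using (_↔_; _⇔_)

IsPrimePower : ℕ → Set
IsPrimePower q = Σ ℕ λ p → Σ ℕ λ k → Prime p × 1 ≤ k × q ≡ p ^ k

-- A finite field with exactly N elements (any such field is a model of F_N,
-- unique up to isomorphism).
record FiniteField (N : ℕ) : Set₁ where
  field
    Carrier : Set
    _+_ _*_ : Carrier → Carrier → Carrier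
    -_ : Carrier → Carrier
    0# 1# : Carrier
    isCommutativeRing : IsCommutativeRing _≡_ _+_ _*_ -_ 0# 1#
    0≢1 : 0# ≢ 1#
    inverse : ∀ x → x ≢ 0# → ∃[ y ] (x * y ≡ 1#)
    enumeration : Carrier ↔ Fin N

  infixl 6 _+_ _-_
  infixl 7 _*_

  _-_ : Carrier → Carrier → Carrier
  x - y = x + (- y)

  _^'_ : Carrier → ℕ → Carrier
  x ^' zero = 1#
  x ^' suc n = x * (x ^' n)

  Primitive : Carrier → Set
  Primitive α = ∀ x → x ≢ 0# → ∃[ i ] (α ^' i ≡ x)

  S : ℕ → ℕ → Carrier → Set
  S q ℓ y = ∃[ x ] (x ≢ 0# × x ^' (q ^ ℓ +ℕ 1) ≡ y)

  scale : Carrier → (Carrier → Set) → Carrier → Set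
  scale c T y = ∃[ t ] (T t × y ≡ c * t)

Graph : Set → Set₁
Graph V = V → V → Set

Cayley : ∀ {N} (F : FiniteField N) → (FiniteField.Carrier F → Set) → Graph (FiniteField.Carrier F)
Cayley F T x y = T (y - x)
  where open FiniteField F

Complement : ∀ {V} → Graph V → Graph V
Complement G x y = x ≢ y × ¬ G x y

SameGraph : ∀ {V} → Graph V → Graph V → Set
SameGraph G H = ∀ x y → G x y ⇔ H x y

UnionRange : ∀ {V} → ℕ → ℕ → (ℕ → Graph V) → Graph V
UnionRange a b G x y = ∃[ i ] (a ≤ i × i ≤ b × G i x y)

record _≃G_ {V W : Set} (G : Graph V) (H : Graph W) : Set where
  field
    φ : V ↔ W
    preserves : ∀ x y → G x y ⇔ H (Function.Bundles.Inverse.to φ x) (Function.Bundles.Inverse.to φ y)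

Γ : ∀ {N} (F : FiniteField N) (q ℓ : ℕ) → Graph (FiniteField.Carrier F)
Γ F q ℓ = Cayley F (FiniteField.S F q ℓ)

Γj : ∀ {N} (F : FiniteField N) (α : FiniteField.Carrier F) (q ℓ j : ℕ) → Graph (FiniteField.Carrier F)
Γj F α q ℓ j = Cayley F (FiniteField.scale F (FiniteField._^'_ F α j) (FiniteField.S F q ℓ))

-- Put Q = q^ℓ + 1. As m/ℓ = 2t is even, q^m = ((q^ℓ)^2)^t ≡ 1 (mod Q), since q^ℓ ≡ -1; so Q
-- divides M = q^m - 1. By pigeonhole the primitive element α has order exactly M, so α^i is a
-- Q-th power iff Q ∣ i. Writing a nonzero y - x as α^i with i = Qu + j, it is not in S_ℓ iff
-- 1 ≤ j ≤ q^ℓ, and then y - x = α^j (α^u)^Q ∈ α^j S_ℓ. Multiplication by α^(-j) is an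
-- isomorphism Γ^(j) ≃ Γ, as it is for any nonzero scalar and any connection set.
module Submission where

open import Defs
open import Data.Nat using (ℕ; _^_; _≤_; _<_; _/_; NonZero)
open import Data.Nat.Divisibility using (_∣_)
open import Data.Product using (_×_)

open import Level using (0ℓ)
import Data.Nat as Nat
open import Data.Nat using (zero; suc; _%_; z≤n; s≤s; nonTrivial⇒n>1)
import Data.Nat.Properties as ℕₚ
open import Data.Nat.Divisibility
  using (divides; n∣m*n; %-presˡ-∣; ∣n∣m%n⇒∣m; m%n≡0⇒n∣m; ∣m+n∣m⇒∣n; ∣⇒≤)
open import Data.Nat.DivMod using (m/n*n≡m; m≡m%n+[m/n]*n; m%n<n)
open import Data.Nat.Primality using (prime⇒nonZero; prime⇒nonTrivial)
open import Data.Nat.Tactic.RingSolver using (solve-∀)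
open import Data.Fin using (Fin; toℕ; fromℕ<; punchIn; punchOut)
open import Data.Fin.Properties
  using (punchOut-injective; punchIn-injective; punchInᵢ≢i; injective⇒≤; toℕ-fromℕ<; toℕ<n; pigeonhole)
open import Data.Product using (∃-syntax; _,_; proj₁; proj₂)
open import Relation.Nullary using (¬_; contradiction; yes; no)
open import Relation.Binary.Definitions using (tri<; tri≈; tri>)
open import Relation.Binary.PropositionalEquality
open import Algebra.Bundles using (CommutativeRing)
open import Function.Bundles using (_⇔_; _↔_; mk⇔; mk↔ₛ′; Inverse; Injection)
open import Function.Construct.Composition using (_⇔-∘_)
open import Function.Properties.Inverse using (Inverse⇒Injection; ↔-sym)

module _ where
  open Nat using (_+_; _*_)

  prime-power≥2 : ∀ {q} → IsPrimePower q → 2 ≤ q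
  prime-power≥2 (p , suc k , p-prime , _ , refl) =
    ℕₚ.≤-trans (nonTrivial⇒n>1 p {{prime⇒nonTrivial p-prime}})
               (ℕₚ.m≤m*n p (p ^ k) {{ℕₚ.m^n≢0 p k {{prime⇒nonZero p-prime}}}})

  1+multiple-*-closed : ∀ n i j → (1 + i * n) * (1 + j * n) ≡ 1 + (i + j + i * j * n) * n
  1+multiple-*-closed = solve-∀

  ^-1+multiple : ∀ n i t → ∃[ k ] ((1 + i * n) ^ t ≡ 1 + k * n)
  ^-1+multiple n i zero = 0 , refl
  ^-1+multiple n i (suc t) with ^-1+multiple n i t
  ... | k , eq = i + k + i * k * n , trans (cong ((1 + i * n) *_) eq) (1+multiple-*-closed n i k)

  square≡1+multiple : ∀ b → (1 + b) ^ 2 ≡ 1 + b * (1 + b + 1)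
  square≡1+multiple b = identity b
    where
      identity : ∀ b → (1 + b) * ((1 + b) * 1) ≡ 1 + b * (1 + b + 1)
      identity = solve-∀

  even-power≡1+multiple : ∀ a → 1 ≤ a → ∀ t → ∃[ k ] (a ^ (2 * t) ≡ 1 + k * (a + 1))
  even-power≡1+multiple a@(suc b) _ t with ^-1+multiple (a + 1) b t
  ... | k , eq = k , (begin
    a ^ (2 * t)            ≡⟨ ℕₚ.^-*-assoc a 2 t ⟨
    (a ^ 2) ^ t            ≡⟨ cong (_^ t) (square≡1+multiple b) ⟩
    (1 + b * (a + 1)) ^ t  ≡⟨ eq ⟩
    1 + k * (a + 1)        ∎)
    where open ≡-Reasoning

  ^≡1+M⇒2≤M : ∀ {q m M} → 2 ≤ q → 2 ≤ m → q ^ m ≡ suc M → 2 ≤ M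
  ^≡1+M⇒2≤M {q} {m} {M} 2≤q 2≤m q^m≡1+M = ℕₚ.≤-pred (begin
    3        ≤⟨ ℕₚ.n≤1+n 3 ⟩
    2 ^ 2    ≤⟨ ℕₚ.^-monoˡ-≤ 2 2≤q ⟩
    q ^ 2    ≤⟨ ℕₚ.^-monoʳ-≤ q {{Nat.>-nonZero (ℕₚ.≤-trans (s≤s z≤n) 2≤q)}} 2≤m ⟩
    q ^ m    ≡⟨ q^m≡1+M ⟩
    suc M    ∎)
    where open ℕₚ.≤-Reasoning

  ^-even-multiple≡1+multiple : ∀ q {m ℓ} → 1 ≤ q → .{{_ : NonZero ℓ}} → ℓ ∣ m → 2 ∣ m / ℓ →
                    ∃[ k ] (q ^ m ≡ 1 + k * (q ^ ℓ + 1))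
  ^-even-multiple≡1+multiple q {m} {ℓ} 1≤q ℓ∣m (divides t m/ℓ≡t*2)
    with even-power≡1+multiple (q ^ ℓ) (ℕₚ.^-monoʳ-≤ q {{Nat.>-nonZero 1≤q}} (z≤n {ℓ})) t
  ... | k , eq = k , (begin
    q ^ m              ≡⟨ cong (q ^_) m≡ℓ*[2*t] ⟩
    q ^ (ℓ * (2 * t))  ≡⟨ ℕₚ.^-*-assoc q ℓ (2 * t) ⟨
    (q ^ ℓ) ^ (2 * t)  ≡⟨ eq ⟩
    1 + k * (q ^ ℓ + 1) ∎)
    where
      open ≡-Reasoning
      m≡ℓ*[2*t] : m ≡ ℓ * (2 * t)
      m≡ℓ*[2*t] = begin
        m              ≡⟨ m/n*n≡m ℓ∣m ⟨
        m / ℓ * ℓ      ≡⟨ cong (_* ℓ) m/ℓ≡t*2 ⟩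
        t * 2 * ℓ      ≡⟨ ℕₚ.*-comm (t * 2) ℓ ⟩
        ℓ * (t * 2)    ≡⟨ cong (ℓ *_) (ℕₚ.*-comm t 2) ⟩
        ℓ * (2 * t)    ∎

module FieldProperties {N : ℕ} (F : FiniteField N) where
  open FiniteField F

  commutativeRing : CommutativeRing 0ℓ 0ℓ
  commutativeRing = record
    { Carrier = Carrier ; _≈_ = _≡_ ; _+_ = _+_ ; _*_ = _*_ ; -_ = -_ ; 0# = 0# ; 1# = 1#
    ; isCommutativeRing = isCommutativeRing
    }

  open CommutativeRing commutativeRing using (*-assoc; *-comm; *-identityˡ; *-identityʳ; zeroʳ; -‿inverseʳ)
  open import Algebra.Properties.Ring (CommutativeRing.ring commutativeRing) using (x∙y⁻¹≈ε⇒x≈y; x[y-z]≈xy-xz)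

  Powers : ℕ → Carrier → Set
  Powers e y = ∃[ x ] (x ≢ 0# × x ^' e ≡ y)

  *-inverseˡ-cancel : ∀ {c c⁻¹} → c * c⁻¹ ≡ 1# → ∀ u → c⁻¹ * (c * u) ≡ u
  *-inverseˡ-cancel {c} {c⁻¹} cc⁻¹≡1 u = begin
    c⁻¹ * (c * u)  ≡⟨ *-assoc c⁻¹ c u ⟨
    c⁻¹ * c * u    ≡⟨ cong (_* u) (trans (*-comm c⁻¹ c) cc⁻¹≡1) ⟩
    1# * u         ≡⟨ *-identityˡ u ⟩
    u              ∎
    where open ≡-Reasoning

  *-cancelˡ : ∀ {c u v} → c ≢ 0# → c * u ≡ c * v → u ≡ v
  *-cancelˡ {c} {u} {v} c≢0 cu≡cv with inverse c c≢0
  ... | c⁻¹ , cc⁻¹≡1 =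
    trans (sym (*-inverseˡ-cancel cc⁻¹≡1 u)) (trans (cong (c⁻¹ *_) cu≡cv) (*-inverseˡ-cancel cc⁻¹≡1 v))

  *-nonzero : ∀ {x y} → x ≢ 0# → y ≢ 0# → x * y ≢ 0#
  *-nonzero {x} {y} x≢0 y≢0 xy≡0 = y≢0 (*-cancelˡ x≢0 (trans xy≡0 (sym (zeroʳ x))))

  ^'-nonzero : ∀ {x} → x ≢ 0# → ∀ n → x ^' n ≢ 0#
  ^'-nonzero x≢0 zero 1≡0 = 0≢1 (sym 1≡0)
  ^'-nonzero x≢0 (suc n) = *-nonzero x≢0 (^'-nonzero x≢0 n)

  ^'-homo-* : ∀ x m n → x ^' (m Nat.+ n) ≡ x ^' m * x ^' n
  ^'-homo-* x zero n = sym (*-identityˡ _)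
  ^'-homo-* x (suc m) n = trans (cong (x *_) (^'-homo-* x m n)) (sym (*-assoc x _ _))

  ^'-assocʳ : ∀ x m n → (x ^' m) ^' n ≡ x ^' (m Nat.* n)
  ^'-assocʳ x m zero = cong (x ^'_) (sym (ℕₚ.*-zeroʳ m))
  ^'-assocʳ x m (suc n) = begin
    x ^' m * (x ^' m) ^' n     ≡⟨ cong (x ^' m *_) (^'-assocʳ x m n) ⟩
    x ^' m * x ^' (m Nat.* n)  ≡⟨ ^'-homo-* x m (m Nat.* n) ⟨
    x ^' (m Nat.+ m Nat.* n)   ≡⟨ cong (x ^'_) (ℕₚ.*-suc m n) ⟨
    x ^' (m Nat.* suc n)       ∎
    where open ≡-Reasoning

  1^' : ∀ n → 1# ^' n ≡ 1#
  1^' zero = refl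
  1^' (suc n) = trans (*-identityˡ _) (1^' n)

  ^'-divMod : ∀ x i e .{{_ : NonZero e}} → x ^' i ≡ x ^' (i % e) * x ^' (i / e Nat.* e)
  ^'-divMod x i e = trans (cong (x ^'_) (m≡m%n+[m/n]*n i e)) (^'-homo-* x (i % e) _)

  ^'-% : ∀ {x d} .{{_ : NonZero d}} → x ^' d ≡ 1# → ∀ n → x ^' n ≡ x ^' (n % d)
  ^'-% {x} {d} x^d≡1 n = begin
    x ^' n                                ≡⟨ ^'-divMod x n d ⟩
    x ^' (n % d) * x ^' (n / d Nat.* d)   ≡⟨ cong (λ k → x ^' (n % d) * x ^' k) (ℕₚ.*-comm (n / d) d) ⟩
    x ^' (n % d) * x ^' (d Nat.* (n / d)) ≡⟨ cong (x ^' (n % d) *_) (^'-assocʳ x d (n / d)) ⟨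
    x ^' (n % d) * (x ^' d) ^' (n / d)    ≡⟨ cong (λ y → x ^' (n % d) * y ^' (n / d)) x^d≡1 ⟩
    x ^' (n % d) * 1# ^' (n / d)          ≡⟨ cong (x ^' (n % d) *_) (1^' (n / d)) ⟩
    x ^' (n % d) * 1#                     ≡⟨ *-identityʳ _ ⟩
    x ^' (n % d)                          ∎
    where open ≡-Reasoning

  ^'-cancel : ∀ {x} → x ≢ 0# → ∀ {a b} → a ≤ b → x ^' a ≡ x ^' b → x ^' (b Nat.∸ a) ≡ 1#
  ^'-cancel {x} x≢0 {a} {b} a≤b x^a≡x^b = *-cancelˡ (^'-nonzero x≢0 a) (begin
    x ^' a * x ^' (b Nat.∸ a)   ≡⟨ ^'-homo-* x a (b Nat.∸ a) ⟨
    x ^' (a Nat.+ (b Nat.∸ a))  ≡⟨ cong (x ^'_) (ℕₚ.m+[n∸m]≡n a≤b) ⟩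
    x ^' b                      ≡⟨ x^a≡x^b ⟨
    x ^' a                      ≡⟨ *-identityʳ _ ⟨
    x ^' a * 1#                 ∎)
    where open ≡-Reasoning

  complement-Cayley : (T : Carrier → Set) →
                      SameGraph (Complement (Cayley F T)) (Cayley F (λ z → z ≢ 0# × ¬ T z))
  complement-Cayley T x y = mk⇔
    (λ (x≢y , ¬T) → (λ y-x≡0 → x≢y (sym (x∙y⁻¹≈ε⇒x≈y y x y-x≡0))) , ¬T)
    (λ (y-x≢0 , ¬T) → (λ { refl → y-x≢0 (-‿inverseʳ y) }) , ¬T)

  Cayley-scale≃ : ∀ {c} → c ≢ 0# → (T : Carrier → Set) → Cayley F (scale c T) ≃G Cayley F T
  Cayley-scale≃ {c} c≢0 T with inverse c c≢0
  ... | c⁻¹ , cc⁻¹≡1 = record { φ = mk↔ₛ′ (c⁻¹ *_) (c *_) c-cancel c⁻¹-cancel ; preserves = preserves }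
    where
      c-cancel : ∀ u → c⁻¹ * (c * u) ≡ u
      c-cancel = *-inverseˡ-cancel cc⁻¹≡1
      c⁻¹-cancel : ∀ u → c * (c⁻¹ * u) ≡ u
      c⁻¹-cancel = *-inverseˡ-cancel (trans (*-comm c⁻¹ c) cc⁻¹≡1)
      preserves : ∀ x y → scale c T (y - x) ⇔ T (c⁻¹ * y - c⁻¹ * x)
      preserves x y = mk⇔
        (λ (t , Tt , y-x≡ct) →
           subst T (trans (sym (c-cancel t)) (trans (cong (c⁻¹ *_) (sym y-x≡ct)) (x[y-z]≈xy-xz c⁻¹ y x))) Tt)
        (λ T[c⁻¹y-c⁻¹x] →
           _ , T[c⁻¹y-c⁻¹x] , trans (sym (c⁻¹-cancel (y - x))) (cong (c *_) (x[y-z]≈xy-xz c⁻¹ y x)))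

module PrimitiveElement {N : ℕ} (F : FiniteField N) {M : ℕ} (N≡1+M : N ≡ suc M) (2≤M : 2 ≤ M)
                        {α : FiniteField.Carrier F} (α-primitive : FiniteField.Primitive F α) where
  open FiniteField F
  open FieldProperties F
  open CommutativeRing commutativeRing using (zeroˡ)

  instance
    M-nonZero : NonZero M
    M-nonZero = Nat.>-nonZero (ℕₚ.≤-trans (s≤s z≤n) 2≤M)

  enumeration′ : Carrier ↔ Fin (suc M)
  enumeration′ = subst (λ n → Carrier ↔ Fin n) N≡1+M enumeration

  open Inverse enumeration′ using (strictlyInverseˡ) renaming (to to index; from to element)

  index-injective : ∀ {x y} → index x ≡ index y → x ≡ y
  index-injective = Injection.injective (Inverse⇒Injection enumeration′)

  index0≢index : ∀ {x} → x ≢ 0# → index 0# ≢ index x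
  index0≢index x≢0 index0≡indexx = x≢0 (sym (index-injective index0≡indexx))

  nonzeroIndex : ∀ {x} → x ≢ 0# → Fin M
  nonzeroIndex x≢0 = punchOut (index0≢index x≢0)

  nonzeroIndex-injective : ∀ {x y} (x≢0 : x ≢ 0#) (y≢0 : y ≢ 0#) →
                           nonzeroIndex x≢0 ≡ nonzeroIndex y≢0 → x ≡ y
  nonzeroIndex-injective x≢0 y≢0 eq =
    index-injective (punchOut-injective (index0≢index x≢0) (index0≢index y≢0) eq)

  nonzeroElement : Fin M → Carrier
  nonzeroElement k = element (punchIn (index 0#) k)

  nonzeroElement-nonzero : ∀ k → nonzeroElement k ≢ 0#
  nonzeroElement-nonzero k eq = punchInᵢ≢i (index 0#) k (trans (sym (strictlyInverseˡ _)) (cong index eq))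

  nonzeroElement-injective : ∀ {k k'} → nonzeroElement k ≡ nonzeroElement k' → k ≡ k'
  nonzeroElement-injective eq =
    punchIn-injective (index 0#) _ _ (Injection.injective (Inverse⇒Injection (↔-sym enumeration′)) eq)

  GeneratedBelow : ℕ → Set
  GeneratedBelow d = ∀ x → x ≢ 0# → ∃[ i ] (α ^' toℕ {d} i ≡ x)

  generatedBelow⇒M≤ : ∀ {d} → GeneratedBelow d → M ≤ d
  generatedBelow⇒M≤ {d} generated = injective⇒≤ {f = logarithm} logarithm-injective
    where
      logarithm : Fin M → Fin d
      logarithm k = proj₁ (generated (nonzeroElement k) (nonzeroElement-nonzero k))
      α^logarithm : ∀ k → α ^' toℕ (logarithm k) ≡ nonzeroElement k
      α^logarithm k = proj₂ (generated (nonzeroElement k) (nonzeroElement-nonzero k))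
      logarithm-injective : ∀ {k k'} → logarithm k ≡ logarithm k' → k ≡ k'
      logarithm-injective {k} {k'} eq =
        nonzeroElement-injective
          (trans (sym (α^logarithm k)) (trans (cong (λ i → α ^' toℕ i) eq) (α^logarithm k')))

  ^≡1⇒generatedBelow : ∀ d .{{_ : NonZero d}} → α ^' d ≡ 1# → GeneratedBelow d
  ^≡1⇒generatedBelow d α^d≡1 x x≢0 with α-primitive x x≢0
  ... | i , α^i≡x = fromℕ< (m%n<n i d) , (begin
    α ^' toℕ (fromℕ< (m%n<n i d))  ≡⟨ cong (α ^'_) (toℕ-fromℕ< (m%n<n i d)) ⟩
    α ^' (i % d)                   ≡⟨ ^'-% α^d≡1 i ⟨
    α ^' i                         ≡⟨ α^i≡x ⟩
    x                              ∎)
    where open ≡-Reasoning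

  ^≡1⇒M≤ : ∀ {d} → 1 ≤ d → α ^' d ≡ 1# → M ≤ d
  ^≡1⇒M≤ {suc d} _ α^d≡1 = generatedBelow⇒M≤ (^≡1⇒generatedBelow (suc d) α^d≡1)

  α≢0 : α ≢ 0#
  α≢0 α≡0 = ℕₚ.<⇒≱ 2≤M (generatedBelow⇒M≤ {1} generatedBy1)
    where
      generatedBy1 : GeneratedBelow 1
      generatedBy1 x x≢0 with α-primitive x x≢0
      ... | zero , 1≡x = Fin.zero , 1≡x
      ... | suc i , α^[1+i]≡x =
        contradiction (trans (sym α^[1+i]≡x) (trans (cong (_* α ^' i) α≡0) (zeroˡ _))) x≢0

  α^M≡1 : α ^' M ≡ 1#
  α^M≡1 with pigeonhole (ℕₚ.n<1+n M) (λ i → nonzeroIndex (^'-nonzero α≢0 (toℕ i)))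
  ... | i , j , i<j , same-index = subst (λ d → α ^' d ≡ 1#) j∸i≡M α^[j∸i]≡1
    where
      α^[j∸i]≡1 : α ^' (toℕ j Nat.∸ toℕ i) ≡ 1#
      α^[j∸i]≡1 = ^'-cancel α≢0 (ℕₚ.<⇒≤ i<j)
        (nonzeroIndex-injective (^'-nonzero α≢0 (toℕ i)) (^'-nonzero α≢0 (toℕ j)) same-index)
      j∸i≡M : toℕ j Nat.∸ toℕ i ≡ M
      j∸i≡M = ℕₚ.≤-antisym (ℕₚ.≤-trans (ℕₚ.m∸n≤m (toℕ j) (toℕ i)) (ℕₚ.m<1+n⇒m≤n (toℕ<n j)))
                           (^≡1⇒M≤ (ℕₚ.m<n⇒0<n∸m i<j) α^[j∸i]≡1)

  ^'-distinct-below : ∀ {a b} → a < b → b < M → α ^' a ≢ α ^' b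
  ^'-distinct-below {a} {b} a<b b<M α^a≡α^b =
    ℕₚ.<⇒≱ (ℕₚ.≤-<-trans (ℕₚ.m∸n≤m b a) b<M)
           (^≡1⇒M≤ (ℕₚ.m<n⇒0<n∸m a<b) (^'-cancel α≢0 (ℕₚ.<⇒≤ a<b) α^a≡α^b))

  ^'-injective-below : ∀ {a b} → a < M → b < M → α ^' a ≡ α ^' b → a ≡ b
  ^'-injective-below {a} {b} a<M b<M α^a≡α^b with ℕₚ.<-cmp a b
  ... | tri< a<b _ _ = contradiction α^a≡α^b (^'-distinct-below a<b b<M)
  ... | tri≈ _ a≡b _ = a≡b
  ... | tri> _ _ b<a = contradiction (sym α^a≡α^b) (^'-distinct-below b<a a<M)

  ^'-injective-mod : ∀ {a b} → α ^' a ≡ α ^' b → a % M ≡ b % M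
  ^'-injective-mod {a} {b} α^a≡α^b = ^'-injective-below (m%n<n a M) (m%n<n b M)
    (trans (sym (^'-% α^M≡1 a)) (trans α^a≡α^b (^'-% α^M≡1 b)))

  ∣⇒α^∈Powers : ∀ e {i} → e ∣ i → Powers e (α ^' i)
  ∣⇒α^∈Powers e (divides t refl) = α ^' t , ^'-nonzero α≢0 t , ^'-assocʳ α t e

  α^∈Powers⇒∣ : ∀ {e} → e ∣ M → ∀ {i} → Powers e (α ^' i) → e ∣ i
  α^∈Powers⇒∣ {e} e∣M {i} (x , x≢0 , x^e≡α^i) with α-primitive x x≢0
  ... | u , α^u≡x =
    ∣n∣m%n⇒∣m e∣M (subst (e ∣_) (^'-injective-mod α^[u*e]≡α^i) (%-presˡ-∣ (n∣m*n u) e∣M))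
    where
      α^[u*e]≡α^i : α ^' (u Nat.* e) ≡ α ^' i
      α^[u*e]≡α^i = trans (sym (^'-assocʳ α u e)) (trans (cong (_^' e) α^u≡x) x^e≡α^i)

  module _ (r : ℕ) (r+1∣M : r Nat.+ 1 ∣ M) where
    private
      e : ℕ
      e = r Nat.+ 1

      instance
        e-nonZero : NonZero e
        e-nonZero = Nat.≢-nonZero (ℕₚ.m+1+n≢0 r)

      <e⇒≤r : ∀ {j} → j < e → j ≤ r
      <e⇒≤r {j} j<e = ℕₚ.m<1+n⇒m≤n (subst (j <_) (ℕₚ.+-comm r 1) j<e)

    ScaledPower : Carrier → Set
    ScaledPower y = ∃[ j ] (1 ≤ j × j ≤ r × scale (α ^' j) (Powers e) y)

    nonPower⇒scaledPower : ∀ {y} → y ≢ 0# → ¬ Powers e y → ScaledPower y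
    nonPower⇒scaledPower {y} y≢0 y∉Powers with α-primitive y y≢0
    ... | i , α^i≡y with i % e ℕₚ.≟ 0
    ...   | yes i%e≡0 =
      contradiction (subst (Powers e) α^i≡y (∣⇒α^∈Powers e (m%n≡0⇒n∣m i e i%e≡0))) y∉Powers
    ...   | no i%e≢0 = i % e , ℕₚ.n≢0⇒n>0 i%e≢0 , <e⇒≤r (m%n<n i e) ,
      α ^' (i / e Nat.* e) , ∣⇒α^∈Powers e (n∣m*n (i / e)) , trans (sym α^i≡y) (^'-divMod α i e)

    scaledPower⇒nonzero : ∀ {y} → ScaledPower y → y ≢ 0#
    scaledPower⇒nonzero (j , _ , _ , t , (w , w≢0 , w^e≡t) , y≡α^j*t) y≡0 =
      *-nonzero (^'-nonzero α≢0 j) (subst (_≢ 0#) w^e≡t (^'-nonzero w≢0 e)) (trans (sym y≡α^j*t) y≡0)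

    scaledPower⇒nonPower : ∀ {y} → ScaledPower y → ¬ Powers e y
    scaledPower⇒nonPower {y} (j , 1≤j , j≤r , t , (w , w≢0 , w^e≡t) , y≡α^j*t) y∈Powers
      with α-primitive w w≢0
    ... | a , α^a≡w = ℕₚ.<⇒≱ (ℕₚ.m<m+n r (s≤s z≤n)) (ℕₚ.≤-trans e≤j j≤r)
      where
        y≡α^[j+a*e] : y ≡ α ^' (j Nat.+ a Nat.* e)
        y≡α^[j+a*e] = begin
          y                            ≡⟨ y≡α^j*t ⟩
          α ^' j * t                   ≡⟨ cong (α ^' j *_) (trans (sym w^e≡t) (cong (_^' e) (sym α^a≡w))) ⟩
          α ^' j * (α ^' a) ^' e       ≡⟨ cong (α ^' j *_) (^'-assocʳ α a e) ⟩
          α ^' j * α ^' (a Nat.* e)    ≡⟨ ^'-homo-* α j (a Nat.* e) ⟨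
          α ^' (j Nat.+ a Nat.* e)     ∎
          where open ≡-Reasoning
        e∣j+a*e : e ∣ j Nat.+ a Nat.* e
        e∣j+a*e = α^∈Powers⇒∣ r+1∣M (subst (Powers e) y≡α^[j+a*e] y∈Powers)
        e∣j : e ∣ j
        e∣j = ∣m+n∣m⇒∣n (subst (e ∣_) (ℕₚ.+-comm j (a Nat.* e)) e∣j+a*e) (n∣m*n a)
        e≤j : e ≤ j
        e≤j = ∣⇒≤ {{Nat.>-nonZero 1≤j}} e∣j

    nonPower⇔scaledPower : ∀ y → (y ≢ 0# × ¬ Powers e y) ⇔ ScaledPower y
    nonPower⇔scaledPower y = mk⇔
      (λ (y≢0 , y∉Powers) → nonPower⇒scaledPower y≢0 y∉Powers)
      (λ y∈ScaledPower → scaledPower⇒nonzero y∈ScaledPower , scaledPower⇒nonPower y∈ScaledPower)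

    complement-Cayley-Powers : SameGraph (Complement (Cayley F (Powers e)))
                                         (UnionRange 1 r (λ j → Cayley F (scale (α ^' j) (Powers e))))
    complement-Cayley-Powers x y = nonPower⇔scaledPower (y - x) ⇔-∘ complement-Cayley (Powers e) x y

lemma4p2 : (q m ℓ : ℕ) → IsPrimePower q → 2 ≤ m → .{{_ : NonZero ℓ}} → ℓ ∣ m → ℓ < m → 2 ∣ (m / ℓ)
    → (F : FiniteField (q ^ m)) → (α : FiniteField.Carrier F) → FiniteField.Primitive F α
    → SameGraph (Complement (Γ F q ℓ)) (UnionRange 1 (q ^ ℓ) (Γj F α q ℓ))
      × (∀ j → 1 ≤ j → j ≤ q ^ ℓ → Γj F α q ℓ j ≃G Γ F q ℓ)
lemma4p2 q m ℓ q-prime-power 2≤m ℓ∣m _ 2∣m/ℓ F α α-primitive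
  with ^-even-multiple≡1+multiple q (ℕₚ.<⇒≤ (prime-power≥2 q-prime-power)) ℓ∣m 2∣m/ℓ
... | k , q^m≡1+k*Q =
  complement-Cayley-Powers (q ^ ℓ) (n∣m*n k) ,
  λ j _ _ → Cayley-scale≃ (^'-nonzero α≢0 j) (FiniteField.S F q ℓ)
  where
    open FieldProperties F
    open PrimitiveElement F q^m≡1+k*Q (^≡1+M⇒2≤M (prime-power≥2 q-prime-power) 2≤m q^m≡1+k*Q)
                          α-primitive
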